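{- For a positive integer $m$, let $p_{=m}(m)$, $p_{\leq m}(m)$, $p_{<m}(m)$ denote the numbers of partitions of $m$ whose product of summands is equal to $m$, at most $m$, and strictly less than $m$, respectively. Then: (1) for every positive integer $n$, $p_{\leq n}(n)=p_{<n+1}(n+1)$; (2) for every integer $n\ge 2$, $p_{\leq n}(n)=p_{=n}(n)+p_{\leq n-1}(n-1)$.
   Context: A partition of a non-negative integer $n$ is a representation of $n$ as a sum of unordered positive integers (its parts or summands). The product of the summands of a partition is the product of all its parts counted with multiplicity. -}

module Defs where

open import Data.Nat using (ℕ; zero; suc; _+_; _*_; _∸_; _≤_; _<_; _≤?_; _<?_; _≟_)
open import Data.List using (List; []; _∷_; map; concatMap; length; filter; upTo)
open import Data.Nat.ListAction using (product)
open import Level using (0ℓ)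
open import Relation.Unary using (Pred; Decidable)

-- A partition of n is represented canonically as a non-increasing list of
-- positive integers (its parts) whose sum is n.

-- partsBounded fuel k n : all non-increasing lists of positive integers with
-- every part ≤ k and sum n (fuel ≥ n guarantees completeness).
partsBounded : ℕ → ℕ → ℕ → List (List ℕ)
partsBounded _ _ zero = [] ∷ []
partsBounded zero _ (suc _) = []
partsBounded (suc fuel) k (suc n) =
  concatMap (λ i → let p = suc i in
                   map (p ∷_) (partsBounded fuel p (suc n ∸ p)))
            (filter (λ i → suc i ≤? k) (upTo (suc n)))

partitions : ℕ → List (List ℕ)
partitions n = partsBounded n n n

countPartitions : {P : Pred (List ℕ) 0ℓ} → Decidable P → ℕ → ℕ
countPartitions P? n = length (filter P? (partitions n))

pEq : ℕ → ℕ → ℕ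
pEq m n = countPartitions (λ l → product l ≟ m) n

pLe : ℕ → ℕ → ℕ
pLe m n = countPartitions (λ l → product l ≤? m) n

pLt : ℕ → ℕ → ℕ
pLt m n = countPartitions (λ l → product l <? m) n

{-# OPTIONS --safe #-}
-- If a partition of n + 1 has product at most n, it has a part 1: were all parts
-- at least 2, its sum would be at most its product. Deleting that last 1 is thus a
-- product-preserving bijection onto the partitions of n with product at most n,
-- which gives (1) since product ≤ n means product < n + 1. Splitting "product ≤ n + 2"
-- into "= n + 2" and "< n + 2" and applying (1) to n + 1 gives (2).
module Submission where

open import Defs
open import Data.Nat using (ℕ; zero; suc; _+_; _*_; _∸_; _≤_; z≤n; s≤s; _≤?_)
open import Data.Nat.Properties
open import Data.Nat.ListAction using (sum; product)
open import Data.Nat.ListAction.Properties using (sum-++; product-++)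
open import Data.List using (List; []; _∷_; _∷ʳ_; map; concatMap; length; filter; upTo)
open import Data.List.Properties using (∷ʳ-injectiveˡ; length-map; ∷-injectiveˡ; ∷-injectiveʳ; filter-≐)
open import Data.List.Membership.Propositional using (_∈_; find; lose)
open import Data.List.Membership.Propositional.Properties
open import Data.List.Membership.Propositional.Properties.WithK using (unique∧set⇒bag)
open import Data.List.Relation.Unary.Any using (here)
open import Data.List.Relation.Unary.All using (All; []; _∷_)
import Data.List.Relation.Unary.All as All
import Data.List.Relation.Unary.All.Properties as All
open import Data.List.Relation.Unary.AllPairs using ([]; _∷_)
import Data.List.Relation.Unary.AllPairs as AllPairs
import Data.List.Relation.Unary.AllPairs.Properties as AllPairs
open import Data.List.Relation.Unary.Unique.Propositional using (Unique)
import Data.List.Relation.Unary.Unique.Propositional.Properties as Unique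
open import Data.List.Relation.Binary.BagAndSetEquality using (∼bag⇒↭)
open import Data.List.Relation.Binary.Permutation.Propositional.Properties using (↭-length)
open import Data.Product using (_×_; _,_; ∃)
open import Data.Sum using (_⊎_; inj₁; inj₂; [_,_])
open import Data.Empty using (⊥-elim)
open import Function.Bundles using (mk⇔)
open import Level using (Level)
open import Relation.Nullary using (¬_; yes; no)
open import Relation.Unary using (Pred; Decidable; _⊆_)
open import Relation.Binary.PropositionalEquality hiding ([_])

private variable
  a : Level
  A B : Set a

length-≡-unique : {xs ys : List A} → Unique xs → Unique ys →
                  (∀ {z} → z ∈ xs → z ∈ ys) → (∀ {z} → z ∈ ys → z ∈ xs) →
                  length xs ≡ length ys
length-≡-unique ux uy xs⊆ys ys⊆xs =
  ↭-length (∼bag⇒↭ (unique∧set⇒bag ux uy (mk⇔ xs⊆ys ys⊆xs)))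

concatMap-unique : (g : A → List B) {is : List A} → Unique is → (∀ i → Unique (g i)) →
                   (∀ {i j x} → x ∈ g i → x ∈ g j → i ≡ j) → Unique (concatMap g is)
concatMap-unique g u g-unique g-disjoint =
  Unique.concat⁺ (All.map⁺ (All.universal g-unique _))
                 (AllPairs.map⁺ (AllPairs.map (λ i≢j {_} (x∈gi , x∈gj) → i≢j (g-disjoint x∈gi x∈gj)) u))

module _ {p} {P Q R : Pred A p} (P? : Decidable P) (Q? : Decidable Q) (R? : Decidable R)
         (P⊆Q∪R : ∀ {x} → P x → Q x ⊎ R x) (Q⊆P : Q ⊆ P) (R⊆P : R ⊆ P) (Q∩R=∅ : ∀ {x} → Q x → ¬ R x) where

  length-filter-⊎ : ∀ xs → length (filter P? xs) ≡ length (filter Q? xs) + length (filter R? xs)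
  length-filter-⊎ [] = refl
  length-filter-⊎ (x ∷ xs) with ih ← length-filter-⊎ xs | P? x | Q? x | R? x
  ... | yes _  | yes q  | yes r  = ⊥-elim (Q∩R=∅ q r)
  ... | yes _  | yes _  | no  _  = cong suc ih
  ... | yes _  | no  _  | yes _  = trans (cong suc ih) (sym (+-suc _ _))
  ... | yes px | no ¬qx | no ¬rx = ⊥-elim ([ ¬qx , ¬rx ] (P⊆Q∪R px))
  ... | no ¬px | yes qx | _      = ⊥-elim (¬px (Q⊆P qx))
  ... | no ¬px | no  _  | yes rx = ⊥-elim (¬px (R⊆P rx))
  ... | no  _  | no  _  | no  _  = ih

infixr 5 _∷_

data NonIncreasing : ℕ → List ℕ → Set where
  []  : ∀ {k} → NonIncreasing k []
  _∷_ : ∀ {k i l} → suc i ≤ k → NonIncreasing (suc i) l → NonIncreasing k (suc i ∷ l)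

NonIncreasing-weaken : ∀ {k k′ l} → k ≤ k′ → NonIncreasing k l → NonIncreasing k′ l
NonIncreasing-weaken k≤k′ []          = []
NonIncreasing-weaken k≤k′ (i≤k ∷ ni) = ≤-trans i≤k k≤k′ ∷ ni

NonIncreasing-sum : ∀ {k l} → NonIncreasing k l → NonIncreasing (sum l) l
NonIncreasing-sum []                       = []
NonIncreasing-sum (_∷_ {i = i} {l} _ ni) = m≤m+n (suc i) (sum l) ∷ ni

NonIncreasing-∷ʳ1 : ∀ {k l} → 1 ≤ k → NonIncreasing k l → NonIncreasing k (l ∷ʳ 1)
NonIncreasing-∷ʳ1 1≤k []          = 1≤k ∷ []
NonIncreasing-∷ʳ1 1≤k (i≤k ∷ ni) = i≤k ∷ NonIncreasing-∷ʳ1 (s≤s z≤n) ni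

NonIncreasing-∷ʳ1⁻ : ∀ {k l} → NonIncreasing k l →
                     All (2 ≤_) l ⊎ ∃ λ l′ → l ≡ l′ ∷ʳ 1 × NonIncreasing k l′
NonIncreasing-∷ʳ1⁻ [] = inj₁ []
NonIncreasing-∷ʳ1⁻ (_∷_ {i = i} i≤k ni) with NonIncreasing-∷ʳ1⁻ ni
... | inj₂ (l′ , refl , ni′) = inj₂ (suc i ∷ l′ , refl , i≤k ∷ ni′)
NonIncreasing-∷ʳ1⁻ (_∷_ {i = suc i} _ _)  | inj₁ 2≤l = inj₁ (s≤s (s≤s z≤n) ∷ 2≤l)
NonIncreasing-∷ʳ1⁻ (_∷_ {i = zero} _ [])  | inj₁ _   = inj₂ ([] , refl , [])
NonIncreasing-∷ʳ1⁻ (_∷_ {i = zero} _ (s≤s z≤n ∷ _)) | inj₁ (s≤s () ∷ _)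

∈-partsBounded⁻ : ∀ fuel k n {l} → l ∈ partsBounded fuel k n → NonIncreasing k l × sum l ≡ n
∈-partsBounded⁻ fuel k zero (here refl) = [] , refl
∈-partsBounded⁻ (suc fuel) k (suc n) l∈
  with i , i∈ , l∈′ ← find (∈-concatMap⁻ (λ i → map (suc i ∷_) (partsBounded fuel (suc i) (n ∸ i)))
                                          {xs = filter (λ i → suc i ≤? k) (upTo (suc n))} l∈)
  with i<1+n , i<k ← ∈-filter⁻ (λ i → suc i ≤? k) i∈
  with l′ , l′∈ , refl ← ∈-map⁻ (suc i ∷_) l∈′
  with ni , sum≡n∸i ← ∈-partsBounded⁻ fuel (suc i) (n ∸ i) l′∈
  = i<k ∷ ni , cong suc (trans (cong (i +_) sum≡n∸i) (m+[n∸m]≡n (≤-pred (∈-upTo⁻ i<1+n))))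

∈-partsBounded⁺ : ∀ fuel k {l} → NonIncreasing k l → sum l ≤ fuel → l ∈ partsBounded fuel k (sum l)
∈-partsBounded⁺ fuel k [] _ = here refl
∈-partsBounded⁺ (suc fuel) k (_∷_ {i = i} {l} i<k ni) (s≤s sum≤fuel) =
  ∈-concatMap⁺ (λ j → map (suc j ∷_) (partsBounded fuel (suc j) (i + sum l ∸ j)))
    (lose (∈-filter⁺ (λ i → suc i ≤? k) (∈-upTo⁺ (s≤s (m≤m+n i (sum l)))) i<k)
          (∈-map⁺ (suc i ∷_) l∈))
  where
  l∈ : l ∈ partsBounded fuel (suc i) (i + sum l ∸ i)
  l∈ = subst (λ n → l ∈ partsBounded fuel (suc i) n) (sym (m+n∸m≡n i (sum l)))
             (∈-partsBounded⁺ fuel (suc i) ni (≤-trans (m≤n+m (sum l) i) sum≤fuel))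

partsBounded-unique : ∀ fuel k n → Unique (partsBounded fuel k n)
partsBounded-unique fuel k zero = [] ∷ []
partsBounded-unique zero k (suc n) = []
partsBounded-unique (suc fuel) k (suc n) =
  concatMap-unique _ (Unique.filter⁺ (λ i → suc i ≤? k) (Unique.upTo⁺ (suc n)))
    (λ i → Unique.map⁺ ∷-injectiveʳ (partsBounded-unique fuel (suc i) (n ∸ i)))
    heads-differ
  where
  heads-differ : ∀ {i j : ℕ} {x} → x ∈ map (suc i ∷_) (partsBounded fuel (suc i) (n ∸ i)) →
                 x ∈ map (suc j ∷_) (partsBounded fuel (suc j) (n ∸ j)) → i ≡ j
  heads-differ x∈ y∈ with _ , _ , refl ← ∈-map⁻ _ x∈ | _ , _ , x≡ ← ∈-map⁻ _ y∈ =
    suc-injective (∷-injectiveˡ x≡)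

∈-partitions⁻ : ∀ {n l} → l ∈ partitions n → NonIncreasing n l × sum l ≡ n
∈-partitions⁻ {n} = ∈-partsBounded⁻ n n n

∈-partitions⁺ : ∀ {k l} → NonIncreasing k l → l ∈ partitions (sum l)
∈-partitions⁺ ni = ∈-partsBounded⁺ _ _ (NonIncreasing-sum ni) ≤-refl

partitions-unique : ∀ n → Unique (partitions n)
partitions-unique n = partsBounded-unique n n n

m+n≤m*n : ∀ {m n} → 2 ≤ m → 2 ≤ n → m + n ≤ m * n
m+n≤m*n {m} {suc n} 2≤m (s≤s 1≤n) = begin
  m + suc n    ≡⟨ cong (m +_) (+-comm 1 n) ⟩
  m + (n + 1)  ≤⟨ +-monoʳ-≤ m (+-monoʳ-≤ n 1≤n) ⟩
  m + (n + n)  ≡⟨ cong (λ k → m + (n + k)) (+-identityʳ n) ⟨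
  m + 2 * n    ≤⟨ +-monoʳ-≤ m (*-monoˡ-≤ n 2≤m) ⟩
  m + m * n    ≡⟨ *-suc m n ⟨
  m * suc n    ∎
  where open ≤-Reasoning

product-positive : ∀ {l} → All (1 ≤_) l → 1 ≤ product l
product-positive []           = ≤-refl
product-positive (1≤x ∷ 1≤l) = *-mono-≤ 1≤x (product-positive 1≤l)

sum≤product : ∀ {l} → All (2 ≤_) l → sum l ≤ product l
sum≤product []                = z≤n
sum≤product (_∷_ {x} 2≤x [])  = ≤-reflexive (trans (+-identityʳ x) (sym (*-identityʳ x)))
sum≤product (_∷_ {x} 2≤x (_∷_ {y} {l} 2≤y 2≤l)) = begin
  x + (y + sum l)      ≤⟨ +-monoʳ-≤ x (sum≤product (2≤y ∷ 2≤l)) ⟩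
  x + product (y ∷ l)  ≤⟨ m+n≤m*n 2≤x (*-mono-≤ 2≤y (product-positive (All.map (≤-trans (s≤s z≤n)) 2≤l))) ⟩
  x * product (y ∷ l)  ∎
  where open ≤-Reasoning

partitionsProduct≤ : ℕ → ℕ → List (List ℕ)
partitionsProduct≤ m n = filter (λ l → product l ≤? m) (partitions n)

sum-∷ʳ1 : ∀ l → sum (l ∷ʳ 1) ≡ suc (sum l)
sum-∷ʳ1 l = trans (sum-++ l (1 ∷ [])) (+-comm (sum l) 1)

product-∷ʳ1 : ∀ l → product (l ∷ʳ 1) ≡ product l
product-∷ʳ1 l = trans (product-++ l (1 ∷ [])) (*-identityʳ (product l))

∷ʳ1-∈-partitionsProduct≤ : ∀ {m n l} → l ∈ partitionsProduct≤ m n → l ∷ʳ 1 ∈ partitionsProduct≤ m (suc n)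
∷ʳ1-∈-partitionsProduct≤ {m} {n} {l} l∈
  with l∈ₚ , prod≤m ← ∈-filter⁻ (λ l → product l ≤? m) {xs = partitions n} l∈
  with ni , refl ← ∈-partitions⁻ {n} l∈ₚ =
  ∈-filter⁺ (λ l → product l ≤? m)
    (subst (λ s → l ∷ʳ 1 ∈ partitions s) (sum-∷ʳ1 l)
      (∈-partitions⁺ (NonIncreasing-∷ʳ1 (s≤s z≤n) (NonIncreasing-weaken (n≤1+n (sum l)) ni))))
    (subst (_≤ m) (sym (product-∷ʳ1 l)) prod≤m)

∈-partitionsProduct≤-suc⁻ : ∀ {m n l} → m ≤ n → l ∈ partitionsProduct≤ m (suc n) →
                            ∃ λ l′ → l ≡ l′ ∷ʳ 1 × l′ ∈ partitionsProduct≤ m n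
∈-partitionsProduct≤-suc⁻ {m} {n} {l} m≤n l∈
  with l∈ₚ , prod≤m ← ∈-filter⁻ (λ l → product l ≤? m) {xs = partitions (suc n)} l∈
  with ni , sum≡1+n ← ∈-partitions⁻ l∈ₚ
  with NonIncreasing-∷ʳ1⁻ ni
... | inj₁ 2≤l = ⊥-elim (<-irrefl sum≡1+n (≤-trans (s≤s (sum≤product 2≤l)) (s≤s (≤-trans prod≤m m≤n))))
... | inj₂ (l′ , refl , ni′) = l′ , refl ,
  ∈-filter⁺ (λ l → product l ≤? m)
    (subst (λ s → l′ ∈ partitions s) (suc-injective (trans (sym (sum-∷ʳ1 l′)) sum≡1+n)) (∈-partitions⁺ ni′))
    (subst (_≤ m) (product-∷ʳ1 l′) prod≤m)

length-partitionsProduct≤-suc : ∀ {m n} → m ≤ n →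
                                length (partitionsProduct≤ m n) ≡ length (partitionsProduct≤ m (suc n))
length-partitionsProduct≤-suc {m} {n} m≤n = begin
  length (partitionsProduct≤ m n)                   ≡⟨ length-map (_∷ʳ 1) (partitionsProduct≤ m n) ⟨
  length (map (_∷ʳ 1) (partitionsProduct≤ m n))     ≡⟨ length-≡-unique unique-∷ʳ1 (unique (suc n)) ∷ʳ1-∈ ∈-∷ʳ1 ⟩
  length (partitionsProduct≤ m (suc n))             ∎
  where
  open ≡-Reasoning
  unique : ∀ n → Unique (partitionsProduct≤ m n)
  unique n = Unique.filter⁺ _ (partitions-unique n)
  unique-∷ʳ1 : Unique (map (_∷ʳ 1) (partitionsProduct≤ m n))
  unique-∷ʳ1 = Unique.map⁺ (∷ʳ-injectiveˡ _ _) (unique n)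
  ∷ʳ1-∈ : ∀ {l} → l ∈ map (_∷ʳ 1) (partitionsProduct≤ m n) → l ∈ partitionsProduct≤ m (suc n)
  ∷ʳ1-∈ l∈ with _ , l′∈ , refl ← ∈-map⁻ (_∷ʳ 1) l∈ = ∷ʳ1-∈-partitionsProduct≤ {m} {n} l′∈
  ∈-∷ʳ1 : ∀ {l} → l ∈ partitionsProduct≤ m (suc n) → l ∈ map (_∷ʳ 1) (partitionsProduct≤ m n)
  ∈-∷ʳ1 l∈ with _ , refl , l′∈ ← ∈-partitionsProduct≤-suc⁻ {m} {n} m≤n l∈ = ∈-map⁺ (_∷ʳ 1) l′∈

pLe≡pLt-suc : ∀ m n → pLe m n ≡ pLt (suc m) n
pLe≡pLt-suc m n =
  cong length (filter-≐ (λ l → product l ≤? m) (λ l → product l <? suc m) (s≤s , ≤-pred) (partitions n))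

pLe≡pEq+pLt : ∀ m n → pLe m n ≡ pEq m n + pLt m n
pLe≡pEq+pLt m n =
  length-filter-⊎ (λ l → product l ≤? m) (λ l → product l ≟ m) (λ l → product l <? m)
    (λ prod≤m → [ inj₂ , inj₁ ] (m≤n⇒m<n∨m≡n prod≤m)) ≤-reflexive <⇒≤ <-irrefl
    (partitions n)

pLe≡pLt-suc-suc : ∀ n → pLe n n ≡ pLt (suc n) (suc n)
pLe≡pLt-suc-suc n = trans (length-partitionsProduct≤-suc {n} ≤-refl) (pLe≡pLt-suc n (suc n))

corollary3 : ((n : ℕ) → 1 ≤ n → pLe n n ≡ pLt (suc n) (suc n))
             × ((n : ℕ) → pLe (suc (suc n)) (suc (suc n)) ≡ pEq (suc (suc n)) (suc (suc n)) + pLe (suc n) (suc n))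
corollary3 = (λ n _ → pLe≡pLt-suc-suc n) , λ n →
  trans (pLe≡pEq+pLt (suc (suc n)) (suc (suc n)))
        (cong (pEq (suc (suc n)) (suc (suc n)) +_) (sym (pLe≡pLt-suc-suc (suc n))))
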